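{- The maps $\Phi$ and $\Psi$ are mutually inverse: (i) for every decreasing tableau $P$, removable cell $(r,c)$ of $P$ and $\alpha\in\{0,1\}$, if $\Psi(P,(r,c),\alpha)=(P',m)$ then $\Phi(P',m)=(P,(r,c),\alpha)$; (ii) for every decreasing tableau $P$ and $m\in\mathbb{Z}_{>0}$, if $\Phi(P,m)=(P',(r,c),\alpha)$ then $\Psi(P',(r,c),\alpha)=(P,m)$.
   Context: Tableaux use English notation; cell $(i,j)$ is in row $i$, column $j$. A decreasing tableau is a filling of the diagram of a partition by positive integers strictly decreasing from left to right along rows and from top to bottom along columns. A cell is removable if it is the last cell of its row and the bottom cell of its column. $P_{>r}$ denotes the tableau obtained by deleting the first $r$ rows of $P$ (rows renumbered from 1), $P_{\ge r}=P_{>r-1}$. A value $x$ is $P$-ejectable if $x$ occurs in the first row of $P$ and either $x-1$ does not occur in the first row, or $x-1$ occurs in the first row and $x-1$ is $P_{>1}$-ejectable (nothing is ejectable in the empty tableau). Bumping path of a removable cell $(r,c)$ of $P$: $m_r$ is the entry at $(r,c)$, and for $i=r-1,\dots,1$, $m_i$ is the smallest entry of row $i$ with $m_i>m_{i+1}$. Reverse insertion $\Psi(P,(r,c),\alpha)=(P',m)$: compute the bumping path $m_r<\dots<m_1$; set $m:=m_1$, $P':=P$. If $\alpha=1$, delete cell $(r,c)$ from $P'$, set $\alpha_r=1$, and process rows $i=r-1,\dots,1$. If $\alpha=0$, set $m_{r+1}=0$, $\alpha_{r+1}=0$, and process rows $i=r,\dots,1$. Processing row $i$ with $R$ the set of entries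 of row $i$ of $P$: (D) if $m_i-1\in R$, leave row $i$, $\alpha_i=\alpha_{i+1}$; (DR) else if $\alpha_{i+1}=1$ and $m_{i+1}\notin R$, replace $m_i$ in row $i$ of $P'$ by $m_{i+1}$, $\alpha_i=1$; otherwise let $x$ be the smallest $P'_{>i}$-ejectable value (current $P'$) with $m_{i+1}<x<m_i$: (IR) if $x$ exists replace $m_i$ by $x$, $\alpha_i=1$; (NR) else leave row $i$, $\alpha_i=0$. Output final $P'$ and $m$. Insertion $\Phi(P,m)=(P',(r,c),\alpha)$: set $P':=P$, $N:=m$, $i:=1$. At iteration $i$, let $R$ be the set of entries of row $i$ of $P$ (empty if no such row), $n_1$ the largest element of $R$ with $n_1\le N$. (T1) If $n_1$ does not exist, append $N$ at the end of row $i$ of $P'$ and output $(P',\text{new cell},1)$. Otherwise replace $n_1$ in row $i$ of $P'$ by $N$, and: (D) if $n_1=N$ and $N-1\in R$, set $N:=N-1$, next iteration; (DR) else if $n_1<N$ and $n_1$ is not $P_{>i}$-ejectable, set $N:=n_1$, next iteration; otherwise let $n_2$ be the entry immediately right of $n_1$ in row $i$ of $P$ ($0$ if none) and $y$ the largest $P_{>i}$-ejectable value with $n_2<y<n_1$: (IR1) if $y$ exists, $N:=y$, next iteration; (IR2) if not and $n_2>0$, $N:=n_2$, next iteration; (T2) if not and $n_2=0$, output $(P',\text{the cell of } N \text{ in row } i,0)$. -}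

module Defs where

open import Data.Nat using (ℕ; zero; suc; _∸_; _<_; _≤_; _≡ᵇ_; _<ᵇ_; _≤ᵇ_; _⊓_; _⊔_)
open import Data.Bool using (Bool; true; false; if_then_else_; _∧_; _∨_; not)
open import Data.List using (List; []; _∷_; _++_; map; length; take; null)
open import Data.List.Relation.Unary.All using (All)
open import Data.List.Relation.Unary.Linked using (Linked)
open import Data.Maybe using (Maybe; just; nothing)
open import Data.Product using (_×_; _,_)
open import Data.Unit using (⊤)
open import Data.Empty using (⊥)
open import Relation.Binary.PropositionalEquality using (_≡_)

-- Tableaux: a tableau is the list of its rows (top to bottom), each row
-- a list of entries (left to right).  Cells are 1-based (row r, column c).

Tableau : Set
Tableau = List (List ℕ)

ColDec : List ℕ → List ℕ → Set
ColDec _        []       = ⊤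
ColDec []       (_ ∷ _)  = ⊥
ColDec (a ∷ as) (b ∷ bs) = (b < a) × ColDec as bs

NonEmpty : List ℕ → Set
NonEmpty []      = ⊥
NonEmpty (_ ∷ _) = ⊤

_>_ : ℕ → ℕ → Set
m > n = n < m

IsDecreasingTableau : Tableau → Set
IsDecreasingTableau P =
  All NonEmpty P × All (All (0 <_)) P × All (Linked _>_) P × Linked ColDec P

-- row r (1-based); empty if absent
rowAt : Tableau → ℕ → List ℕ
rowAt []       _             = []
rowAt (_ ∷ _)  zero          = []
rowAt (x ∷ _)  (suc zero)    = x
rowAt (_ ∷ xs) (suc (suc r)) = rowAt xs (suc r)

-- (r,c) is a cell of P that is last in its row and bottom of its column
Removable : Tableau → ℕ → ℕ → Set
Removable P r c =
  (1 ≤ r) × (1 ≤ c) × (length (rowAt P r) ≡ c) × (length (rowAt P (suc r)) < c)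

_∈ᵇ_ : ℕ → List ℕ → Bool
x ∈ᵇ []       = false
x ∈ᵇ (y ∷ ys) = (x ≡ᵇ y) ∨ (x ∈ᵇ ys)

filter : (ℕ → Bool) → List ℕ → List ℕ
filter p []       = []
filter p (x ∷ xs) = if p x then x ∷ filter p xs else filter p xs

minM : List ℕ → Maybe ℕ
minM []       = nothing
minM (x ∷ xs) with minM xs
... | nothing = just x
... | just y  = just (x ⊓ y)

maxM : List ℕ → Maybe ℕ
maxM []       = nothing
maxM (x ∷ xs) with maxM xs
... | nothing = just x
... | just y  = just (x ⊔ y)

firstRow : Tableau → List ℕ
firstRow []      = []
firstRow (x ∷ _) = x

replace : ℕ → ℕ → List ℕ → List ℕ
replace a b = map (λ z → if z ≡ᵇ a then b else z)

-- entry at 1-based column c (0 if absent)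
entryAt : List ℕ → ℕ → ℕ
entryAt []       _             = 0
entryAt (_ ∷ _)  zero          = 0
entryAt (x ∷ _)  (suc zero)    = x
entryAt (_ ∷ xs) (suc (suc c)) = entryAt xs (suc c)

-- entry immediately to the right of value n in the row (0 if none)
rightOf : ℕ → List ℕ → ℕ
rightOf n []       = 0
rightOf n (x ∷ xs) = if x ≡ᵇ n then firstOr xs else rightOf n xs
  where
  firstOr : List ℕ → ℕ
  firstOr []      = 0
  firstOr (y ∷ _) = y

indexOf : ℕ → List ℕ → ℕ
indexOf n []       = 0
indexOf n (x ∷ xs) = if x ≡ᵇ n then 1 else suc (indexOf n xs)

-- Ejectability: x is P-ejectable iff x occurs in the first row of P and
-- either x-1 does not occur there, or it does and x-1 is P_{>1}-ejectable.
-- (Entries are positive, so for x = 1 the value x ∸ 1 = 0 never occurs.)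

ejectable : Tableau → ℕ → Bool
ejectable []           x = false
ejectable (row ∷ rest) x =
  (x ∈ᵇ row) ∧ (not ((x ∸ 1) ∈ᵇ row) ∨ ejectable rest (x ∸ 1))

-- ejectable values of T strictly between lo and hi (they lie in the first row)
ejectablesBetween : Tableau → ℕ → ℕ → List ℕ
ejectablesBetween T lo hi =
  filter (λ x → ejectable T x ∧ (lo <ᵇ x) ∧ (x <ᵇ hi)) (firstRow T)

-- process row i of the tableau: R = row i of P (= row i of P'),
-- rest' = current P'_{>i}, mi = m_i, m' = m_{i+1}, a' = α_{i+1};
-- returns (new rows i.., m_i, α_i)
processRow : List ℕ → Tableau → ℕ → ℕ → Bool → Tableau × ℕ × Bool
processRow R rest' mi m' a' =
  if (mi ∸ 1) ∈ᵇ R then (R ∷ rest' , mi , a')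
  else if a' ∧ not (m' ∈ᵇ R) then (replace mi m' R ∷ rest' , mi , true)
  else caseIR (minM (ejectablesBetween rest' m' mi))
  where
  caseIR : Maybe ℕ → Tableau × ℕ × Bool
  caseIR (just x) = (replace mi x R ∷ rest' , mi , true)
  caseIR nothing  = (R ∷ rest' , mi , false)

-- smallest entry of the row strictly greater than m (0 if none)
smallestGreater : List ℕ → ℕ → ℕ
smallestGreater row m with minM (filter (m <ᵇ_) row)
... | just y  = y
... | nothing = 0

stepUp : List ℕ → Tableau × ℕ × Bool → Tableau × ℕ × Bool
stepUp row (rest' , m' , a') = processRow row rest' (smallestGreater row m') m' a'

-- psiGo rows r c α : rows are rows i.. of P, (r,c) relative to row i
psiGo : Tableau → ℕ → ℕ → Bool → Tableau × ℕ × Bool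
psiGo []           _             _ _     = ([] , 0 , false)
psiGo (row ∷ rest) zero          _ _     = (row ∷ rest , 0 , false)
psiGo (row ∷ rest) (suc zero)    c true  =
  ((if null (take (c ∸ 1) row) then rest else take (c ∸ 1) row ∷ rest)
  , entryAt row c , true)
psiGo (row ∷ rest) (suc zero)    c false = processRow row rest (entryAt row c) 0 false
psiGo (row ∷ rest) (suc (suc r)) c α     = stepUp row (psiGo rest (suc r) c α)

Ψ : Tableau → ℕ → ℕ → Bool → Tableau × ℕ
Ψ P r c α with psiGo P r c α
... | (P' , m , _) = (P' , m)

-- result: (new rows i.., row of output cell relative to i, column, α)
Out : Set
Out = Tableau × ℕ × ℕ × Bool

shift : List ℕ → Out → Out
shift row' (rest' , r , c , a) = (row' ∷ rest' , suc r , c , a)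

phiGo : Tableau → ℕ → Out
phiGo []           N = ((N ∷ []) ∷ [] , 1 , 1 , true)
phiGo (row ∷ rest) N = caseN1 (maxM (filter (_≤ᵇ N) row))
  where
  caseN1 : Maybe ℕ → Out
  caseN1 nothing   = ((row ++ (N ∷ [])) ∷ rest , 1 , suc (length row) , true)
  caseN1 (just n1) =
    if (n1 ≡ᵇ N) ∧ ((N ∸ 1) ∈ᵇ row) then shift row' (phiGo rest (N ∸ 1))
    else if (n1 <ᵇ N) ∧ not (ejectable rest n1) then shift row' (phiGo rest n1)
    else caseY (maxM (ejectablesBetween rest n2 n1))
    where
    row' : List ℕ
    row' = replace n1 N row
    n2 : ℕ
    n2 = rightOf n1 row
    caseY : Maybe ℕ → Out
    caseY (just y) = shift row' (phiGo rest y)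
    caseY nothing  =
      if 0 <ᵇ n2 then shift row' (phiGo rest n2)
      else (row' ∷ rest , 1 , indexOf n1 row , false)

Φ : Tableau → ℕ → Out
Φ = phiGo

-- Ψ and Φ both treat one row at a time, in opposite directions, and each row step of one is
-- undone by a row step of the other: Ψ's D and DR by Φ's D and DR, Ψ's IR and NR by Φ's IR1/IR2
-- (T2 in the bottom row), and the removal of a cell by T1. The cases match because of the
-- invariant that the flag α_i computed by Ψ is true exactly when m_i is not ejectable from the
-- current P'_{≥i}; with it, both compositions follow by induction on the rows.
module Submission where

open import Defs
open import Data.Nat using (ℕ; zero; suc; _∸_; _<_; _≤_; _≡ᵇ_; _<ᵇ_; _≤ᵇ_; z≤n; s≤s)
open import Data.Nat.Properties
open import Data.Bool using (Bool; true; false; T; T?; if_then_else_; _∧_; not)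
open import Data.List using (List; []; _∷_; _∷ʳ_; initLast; _∷ʳ′_; length; take; null)
open import Data.List.Membership.Propositional using (_∈_; _∉_)
open import Data.List.Membership.Propositional.Properties using (∈-++⁻)
open import Data.List.Relation.Unary.Any using (here; there)
open import Data.List.Relation.Unary.Any.Properties using (¬Any[])
open import Data.List.Relation.Unary.All as All using (All; []; _∷_; zip)
open import Data.List.Relation.Unary.Linked as Linked using (Linked; [-]; _∷_)
open import Data.List.Relation.Unary.Linked.Properties using (Linked⇒All)
open import Data.Maybe using (Maybe; just; nothing)
open import Data.Product using (_×_; _,_; Σ; proj₁; proj₂)
open import Data.Sum using (_⊎_; inj₁; inj₂; [_,_])
open import Relation.Binary.Definitions using (tri<; tri≈; tri>)
open import Function using (flip; _∘_)
open import Relation.Nullary using (¬_; contradiction; yes; no; ¬?)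
open import Relation.Nullary.Decidable using (_×-dec_)
open import Data.List.Membership.DecPropositional _≟_ using (_∈?_)
open import Relation.Nullary.Reflects using (Reflects; ofʸ; ofⁿ; det; fromEquivalence; T-reflects; _×-reflects_; ¬-reflects)
open import Relation.Binary.PropositionalEquality hiding ([_])

reflects-true : ∀ {A : Set} {b} → Reflects A b → b ≡ true → A
reflects-true (ofʸ a) refl = a

true-reflects : ∀ {A : Set} {b} → Reflects A b → A → b ≡ true
true-reflects r a = det r (ofʸ a)

false-reflects : ∀ {A : Set} {b} → Reflects A b → ¬ A → b ≡ false
false-reflects r ¬a = det r (ofⁿ ¬a)

¬T⇒T-not : ∀ {b} → ¬ T b → T (not b)
¬T⇒T-not {false} _  = _
¬T⇒T-not {true}  ¬t = ¬t _

T-not⇒¬T : ∀ {b} → T (not b) → ¬ T b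
T-not⇒¬T {false} _ ()

¬¬T⇒T : ∀ {b} → ¬ ¬ T b → T b
¬¬T⇒T {false} ¬¬t = ¬¬t λ ()
¬¬T⇒T {true}  _   = _

≡ᵇ-reflects-≡ : ∀ m n → Reflects (m ≡ n) (m ≡ᵇ n)
≡ᵇ-reflects-≡ m n = fromEquivalence (≡ᵇ⇒≡ m n) (≡⇒≡ᵇ m n)

∈ᵇ-reflects-∈ : ∀ x xs → Reflects (x ∈ xs) (x ∈ᵇ xs)
∈ᵇ-reflects-∈ x [] = ofⁿ λ ()
∈ᵇ-reflects-∈ x (y ∷ ys) with x ≡ᵇ y | ≡ᵇ-reflects-≡ x y
... | true  | ofʸ refl = ofʸ (here refl)
... | false | ofⁿ x≢y with x ∈ᵇ ys | ∈ᵇ-reflects-∈ x ys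
...   | true  | ofʸ x∈ys  = ofʸ (there x∈ys)
...   | false | ofⁿ x∉ys = ofⁿ λ { (here x≡y) → x≢y x≡y ; (there x∈ys) → x∉ys x∈ys }

∈-filter⁻ : ∀ p xs {z} → z ∈ filter p xs → z ∈ xs × p z ≡ true
∈-filter⁻ p (x ∷ xs) z∈ with p x in px
∈-filter⁻ p (x ∷ xs) (here refl) | true = here refl , px
∈-filter⁻ p (x ∷ xs) (there z∈)  | true = let (z∈xs , pz) = ∈-filter⁻ p xs z∈ in there z∈xs , pz
∈-filter⁻ p (x ∷ xs) z∈          | false = let (z∈xs , pz) = ∈-filter⁻ p xs z∈ in there z∈xs , pz

∈-filter⁺ : ∀ p xs {z} → z ∈ xs → p z ≡ true → z ∈ filter p xs
∈-filter⁺ p (x ∷ xs) (here refl) pz rewrite pz = here refl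
∈-filter⁺ p (x ∷ xs) (there z∈) pz with p x
... | true  = there (∈-filter⁺ p xs z∈ pz)
... | false = ∈-filter⁺ p xs z∈ pz

maxM-nothing : ∀ xs → maxM xs ≡ nothing → xs ≡ []
maxM-nothing [] _ = refl
maxM-nothing (x ∷ xs) e with maxM xs
maxM-nothing (x ∷ xs) () | nothing
maxM-nothing (x ∷ xs) () | just _

minM-nothing : ∀ xs → minM xs ≡ nothing → xs ≡ []
minM-nothing [] _ = refl
minM-nothing (x ∷ xs) e with minM xs
minM-nothing (x ∷ xs) () | nothing
minM-nothing (x ∷ xs) () | just _

maxM-just : ∀ xs {y} → maxM xs ≡ just y → y ∈ xs × (∀ {z} → z ∈ xs → z ≤ y)
maxM-just (x ∷ xs) e with maxM xs in eq
maxM-just (x ∷ xs) refl | nothing rewrite maxM-nothing xs eq = here refl , λ { (here refl) → ≤-refl }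
maxM-just (x ∷ xs) refl | just w with maxM-just xs eq | ≤-total x w
... | w∈ , w-max | inj₁ x≤w rewrite m≤n⇒m⊔n≡n x≤w =
  there w∈ , λ { (here refl) → x≤w ; (there z∈) → w-max z∈ }
... | w∈ , w-max | inj₂ w≤x rewrite m≥n⇒m⊔n≡m w≤x =
  here refl , λ { (here refl) → ≤-refl ; (there z∈) → ≤-trans (w-max z∈) w≤x }

minM-just : ∀ xs {y} → minM xs ≡ just y → y ∈ xs × (∀ {z} → z ∈ xs → y ≤ z)
minM-just (x ∷ xs) e with minM xs in eq
minM-just (x ∷ xs) refl | nothing rewrite minM-nothing xs eq = here refl , λ { (here refl) → ≤-refl }
minM-just (x ∷ xs) refl | just w with minM-just xs eq | ≤-total x w
... | w∈ , w-min | inj₁ x≤w rewrite m≤n⇒m⊓n≡m x≤w =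
  here refl , λ { (here refl) → ≤-refl ; (there z∈) → ≤-trans x≤w (w-min z∈) }
... | w∈ , w-min | inj₂ w≤x rewrite m≥n⇒m⊓n≡n w≤x =
  there w∈ , λ { (here refl) → w≤x ; (there z∈) → w-min z∈ }

Extremal : (ℕ → ℕ → Set) → (ℕ → Set) → List ℕ → ℕ → Set
Extremal _≼_ P xs y = y ∈ xs × P y × (∀ {z} → z ∈ xs → P z → z ≼ y)

Greatest : (ℕ → Set) → List ℕ → ℕ → Set
Greatest = Extremal _≤_

Least : (ℕ → Set) → List ℕ → ℕ → Set
Least = Extremal (flip _≤_)

module BestOfFilter
  (_≼_ : ℕ → ℕ → Set) (≼-antisym : ∀ {x y} → x ≼ y → y ≼ x → x ≡ y)
  (best : List ℕ → Maybe ℕ)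
  (best-nothing : ∀ xs → best xs ≡ nothing → xs ≡ [])
  (best-just : ∀ xs {y} → best xs ≡ just y → y ∈ xs × (∀ {z} → z ∈ xs → z ≼ y))
  {P : ℕ → Set} {p : ℕ → Bool} (p-reflects : ∀ x → Reflects (P x) (p x))
  where

  best-filter-just : ∀ xs {y} → best (filter p xs) ≡ just y → Extremal _≼_ P xs y
  best-filter-just xs e with best-just (filter p xs) e
  ... | y∈ , y-best with ∈-filter⁻ p xs y∈
  ... | y∈xs , py = y∈xs , reflects-true (p-reflects _) py ,
    λ z∈ Pz → y-best (∈-filter⁺ p xs z∈ (true-reflects (p-reflects _) Pz))

  best-filter-nothing : ∀ xs → best (filter p xs) ≡ nothing → ∀ {z} → z ∈ xs → ¬ P z
  best-filter-nothing xs e z∈ Pz =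
    ¬Any[] (subst (_ ∈_) (best-nothing (filter p xs) e) (∈-filter⁺ p xs z∈ (true-reflects (p-reflects _) Pz)))

  Extremal⇒best-filter : ∀ xs {y} → Extremal _≼_ P xs y → best (filter p xs) ≡ just y
  Extremal⇒best-filter xs (y∈ , Py , y-best) with best (filter p xs) in e
  ... | nothing = contradiction Py (best-filter-nothing xs e y∈)
  ... | just w with best-filter-just xs e
  ... | w∈ , Pw , w-best = cong just (≼-antisym (y-best w∈ Pw) (w-best y∈ Py))

  none⇒best-filter : ∀ xs → (∀ {z} → z ∈ xs → ¬ P z) → best (filter p xs) ≡ nothing
  none⇒best-filter xs none with best (filter p xs) in e
  ... | nothing = refl
  ... | just w with best-filter-just xs e
  ... | w∈ , Pw , _ = contradiction Pw (none w∈)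

module Max = BestOfFilter _≤_ ≤-antisym maxM maxM-nothing maxM-just
module Min = BestOfFilter (flip _≤_) (flip ≤-antisym) minM minM-nothing minM-just

WellFormedRow : List ℕ → Set
WellFormedRow R = NonEmpty R × All (0 <_) R × Linked _>_ R

Ejectable : Tableau → ℕ → Set
Ejectable Q x = T (ejectable Q x)

EjectableBetween : Tableau → ℕ → ℕ → ℕ → Set
EjectableBetween Q lo hi x = Ejectable Q x × lo < x × x < hi

GreatestEjectable : Tableau → ℕ → ℕ → ℕ → Set
GreatestEjectable Q lo hi y = EjectableBetween Q lo hi y × (∀ {z} → EjectableBetween Q lo hi z → z ≤ y)

LeastEjectable : Tableau → ℕ → ℕ → ℕ → Set
LeastEjectable Q lo hi y = EjectableBetween Q lo hi y × (∀ {z} → EjectableBetween Q lo hi z → y ≤ z)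

NoEjectable : Tableau → ℕ → ℕ → Set
NoEjectable Q lo hi = ∀ {z} → ¬ EjectableBetween Q lo hi z

ejectable⇒∈ : ∀ Q {x} → Ejectable Q x → x ∈ firstRow Q
ejectable⇒∈ (R ∷ Q) {x} ej with x ∈ᵇ R | ∈ᵇ-reflects-∈ x R
... | true | ofʸ x∈R = x∈R

module _ (Q : Tableau) (lo hi : ℕ) where

  private
    between-reflects : ∀ x → Reflects (EjectableBetween Q lo hi x) (ejectable Q x ∧ (lo <ᵇ x) ∧ (x <ᵇ hi))
    between-reflects x = T-reflects _ ×-reflects (<ᵇ-reflects-< lo x ×-reflects <ᵇ-reflects-< x hi)

    module MaxE = Max between-reflects
    module MinE = Min between-reflects

  maxEjectable-just : ∀ {y} → maxM (ejectablesBetween Q lo hi) ≡ just y → GreatestEjectable Q lo hi y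
  maxEjectable-just e with MaxE.best-filter-just (firstRow Q) e
  ... | _ , ej , greatest = ej , λ ej′ → greatest (ejectable⇒∈ Q (proj₁ ej′)) ej′

  minEjectable-just : ∀ {y} → minM (ejectablesBetween Q lo hi) ≡ just y → LeastEjectable Q lo hi y
  minEjectable-just e with MinE.best-filter-just (firstRow Q) e
  ... | _ , ej , least = ej , λ ej′ → least (ejectable⇒∈ Q (proj₁ ej′)) ej′

  maxEjectable-nothing : maxM (ejectablesBetween Q lo hi) ≡ nothing → NoEjectable Q lo hi
  maxEjectable-nothing e ej = MaxE.best-filter-nothing (firstRow Q) e (ejectable⇒∈ Q (proj₁ ej)) ej

  minEjectable-nothing : minM (ejectablesBetween Q lo hi) ≡ nothing → NoEjectable Q lo hi
  minEjectable-nothing e ej = MinE.best-filter-nothing (firstRow Q) e (ejectable⇒∈ Q (proj₁ ej)) ej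

  GreatestEjectable⇒maxM : ∀ {y} → GreatestEjectable Q lo hi y → maxM (ejectablesBetween Q lo hi) ≡ just y
  GreatestEjectable⇒maxM (ej , greatest) =
    MaxE.Extremal⇒best-filter (firstRow Q) (ejectable⇒∈ Q (proj₁ ej) , ej , λ _ → greatest)

  LeastEjectable⇒minM : ∀ {y} → LeastEjectable Q lo hi y → minM (ejectablesBetween Q lo hi) ≡ just y
  LeastEjectable⇒minM (ej , least) =
    MinE.Extremal⇒best-filter (firstRow Q) (ejectable⇒∈ Q (proj₁ ej) , ej , λ _ → least)

  NoEjectable⇒maxM : NoEjectable Q lo hi → maxM (ejectablesBetween Q lo hi) ≡ nothing
  NoEjectable⇒maxM none = MaxE.none⇒best-filter (firstRow Q) λ _ → none

  NoEjectable⇒minM : NoEjectable Q lo hi → minM (ejectablesBetween Q lo hi) ≡ nothing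
  NoEjectable⇒minM none = MinE.none⇒best-filter (firstRow Q) λ _ → none

module _ {R : List ℕ} (Q : Tableau) {x : ℕ} where

  ejectable-∉ : x ∉ R → ejectable (R ∷ Q) x ≡ false
  ejectable-∉ x∉R rewrite false-reflects (∈ᵇ-reflects-∈ x R) x∉R = refl

  ejectable-pred∉ : x ∈ R → x ∸ 1 ∉ R → ejectable (R ∷ Q) x ≡ true
  ejectable-pred∉ x∈R x-1∉R
    rewrite true-reflects (∈ᵇ-reflects-∈ x R) x∈R | false-reflects (∈ᵇ-reflects-∈ (x ∸ 1) R) x-1∉R = refl

  ejectable-pred∈ : x ∈ R → x ∸ 1 ∈ R → ejectable (R ∷ Q) x ≡ ejectable Q (x ∸ 1)
  ejectable-pred∈ x∈R x-1∈R
    rewrite true-reflects (∈ᵇ-reflects-∈ x R) x∈R | true-reflects (∈ᵇ-reflects-∈ (x ∸ 1) R) x-1∈R = refl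

∈-replace⁻ : ∀ a b R {z} → z ∈ replace a b R → (z ≡ b × a ∈ R) ⊎ (z ∈ R × z ≢ a)
∈-replace⁻ a b (x ∷ xs) z∈ with x ≡ᵇ a | ≡ᵇ-reflects-≡ x a
∈-replace⁻ a b (x ∷ xs) (here z≡b)  | true  | ofʸ refl = inj₁ (z≡b , here refl)
∈-replace⁻ a b (x ∷ xs) (here refl) | false | ofⁿ x≢a = inj₂ (here refl , x≢a)
∈-replace⁻ a b (x ∷ xs) (there z∈) | _ | _ with ∈-replace⁻ a b xs z∈
... | inj₁ (z≡b , a∈xs) = inj₁ (z≡b , there a∈xs)
... | inj₂ (z∈xs , z≢a) = inj₂ (there z∈xs , z≢a)

∈-replace-new : ∀ a b R → a ∈ R → b ∈ replace a b R
∈-replace-new a b (x ∷ xs) (here refl) rewrite true-reflects (≡ᵇ-reflects-≡ a a) refl = here refl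
∈-replace-new a b (x ∷ xs) (there a∈) = there (∈-replace-new a b xs a∈)

∈-replace-old : ∀ a b R {z} → z ∈ R → z ≢ a → z ∈ replace a b R
∈-replace-old a b (x ∷ xs) (here refl) z≢a rewrite false-reflects (≡ᵇ-reflects-≡ x a) z≢a = here refl
∈-replace-old a b (x ∷ xs) (there z∈) z≢a = there (∈-replace-old a b xs z∈ z≢a)

replaced∉ : ∀ a b R → a ≢ b → a ∉ replace a b R
replaced∉ a b R a≢b a∈ with ∈-replace⁻ a b R a∈
... | inj₁ (a≡b , _) = a≢b a≡b
... | inj₂ (_ , a≢a) = a≢a refl

replace-id : ∀ a R → replace a a R ≡ R
replace-id a [] = refl
replace-id a (x ∷ xs) with x ≡ᵇ a | ≡ᵇ-reflects-≡ x a
... | true  | ofʸ refl = cong (a ∷_) (replace-id a xs)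
... | false | ofⁿ _    = cong (x ∷_) (replace-id a xs)

replace-inverse : ∀ a b R → b ∉ R → replace b a (replace a b R) ≡ R
replace-inverse a b [] _ = refl
replace-inverse a b (x ∷ xs) b∉ with x ≡ᵇ a | ≡ᵇ-reflects-≡ x a
... | true | ofʸ refl rewrite true-reflects (≡ᵇ-reflects-≡ b b) refl =
  cong (a ∷_) (replace-inverse a b xs (λ b∈ → b∉ (there b∈)))
... | false | ofⁿ _ rewrite false-reflects (≡ᵇ-reflects-≡ x b) (λ x≡b → b∉ (here (sym x≡b))) =
  cong (x ∷_) (replace-inverse a b xs (λ b∈ → b∉ (there b∈)))

indexOf-replace : ∀ a b R → b ∉ R → indexOf b (replace a b R) ≡ indexOf a R
indexOf-replace a b [] _ = refl
indexOf-replace a b (x ∷ xs) b∉ with x ≡ᵇ a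
... | true rewrite true-reflects (≡ᵇ-reflects-≡ b b) refl = refl
... | false rewrite false-reflects (≡ᵇ-reflects-≡ x b) (λ x≡b → b∉ (here (sym x≡b))) =
  cong suc (indexOf-replace a b xs (λ b∈ → b∉ (there b∈)))

entryAt-replace-indexOf : ∀ a b R → a ∈ R → entryAt (replace a b R) (indexOf a R) ≡ b
entryAt-replace-indexOf a b (x ∷ xs) a∈ with x ≡ᵇ a | ≡ᵇ-reflects-≡ x a
entryAt-replace-indexOf a b (x ∷ xs) a∈          | true  | ofʸ refl = refl
entryAt-replace-indexOf a b (x ∷ xs) (here refl) | false | ofⁿ x≢x = contradiction refl x≢x
entryAt-replace-indexOf a b (x ∷ y ∷ xs) (there a∈) | false | ofⁿ _ with y ≡ᵇ a | entryAt-replace-indexOf a b (y ∷ xs) a∈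
... | true  | ih = ih
... | false | ih = ih

below-head : ∀ {x xs} → Linked _>_ (x ∷ xs) → ∀ {z} → z ∈ xs → z < x
below-head [-] ()
below-head (x>y ∷ l) = All.lookup (Linked⇒All (λ p q → <-trans q p) x>y l)

rightOf-spec : ∀ {v R} → Linked _>_ R → v ∈ R →
  (rightOf v R ≡ 0 × (∀ {z} → z ∈ R → ¬ z < v)) ⊎ Greatest (_< v) R (rightOf v R)
rightOf-spec {v} {x ∷ xs} l v∈ with x ≡ᵇ v | ≡ᵇ-reflects-≡ x v
rightOf-spec {v} {x ∷ []} l v∈ | true | ofʸ refl =
  inj₁ (refl , λ { (here refl) → <-irrefl refl })
rightOf-spec {v} {x ∷ y ∷ ys} l v∈ | true | ofʸ refl =
  inj₂ (there (here refl) , below-head l (here refl) ,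
        λ { (here refl) z<v → contradiction z<v (<-irrefl refl)
          ; (there (here refl)) _ → ≤-refl
          ; (there (there z∈)) _ → <⇒≤ (below-head (Linked.tail l) z∈) })
rightOf-spec {v} {x ∷ xs} l (here refl) | false | ofⁿ x≢x = contradiction refl x≢x
rightOf-spec {v} {x ∷ xs} l (there v∈) | false | ofⁿ _
  with rightOf-spec (Linked.tail l) v∈
... | inj₁ (n2≡0 , none) = inj₁ (n2≡0 , λ { (here refl) x<v → <-asym x<v (below-head l v∈) ; (there z∈) → none z∈ })
... | inj₂ (n2∈ , n2<v , greatest) =
  inj₂ (there n2∈ , n2<v , λ { (here refl) x<v → contradiction (below-head l v∈) (<-asym x<v) ; (there z∈) → greatest z∈ })

rightOf-replace : ∀ a b R → Linked _>_ R → b ∉ R → a ∈ R → rightOf b (replace a b R) ≡ rightOf a R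
rightOf-replace a b (x ∷ xs) l b∉ a∈ with x ≡ᵇ a | ≡ᵇ-reflects-≡ x a
rightOf-replace a b (x ∷ []) l b∉ a∈ | true | ofʸ refl rewrite true-reflects (≡ᵇ-reflects-≡ b b) refl = refl
rightOf-replace a b (x ∷ y ∷ ys) l b∉ a∈ | true | ofʸ refl
  rewrite true-reflects (≡ᵇ-reflects-≡ b b) refl
        | false-reflects (≡ᵇ-reflects-≡ y a) (<⇒≢ (below-head l (here refl))) = refl
rightOf-replace a b (x ∷ xs) l b∉ (here refl) | false | ofⁿ x≢x = contradiction refl x≢x
rightOf-replace a b (x ∷ xs) l b∉ (there a∈) | false | ofⁿ _
  rewrite false-reflects (≡ᵇ-reflects-≡ x b) (λ x≡b → b∉ (here (sym x≡b))) =
  rightOf-replace a b xs (Linked.tail l) (λ b∈ → b∉ (there b∈)) a∈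

length-∷ʳ : ∀ (xs : List ℕ) e → length (xs ∷ʳ e) ≡ suc (length xs)
length-∷ʳ []       e = refl
length-∷ʳ (x ∷ xs) e = cong suc (length-∷ʳ xs e)

take-length-∷ʳ : ∀ (xs : List ℕ) e → take (length xs) (xs ∷ʳ e) ≡ xs
take-length-∷ʳ []       e = refl
take-length-∷ʳ (x ∷ xs) e = cong (x ∷_) (take-length-∷ʳ xs e)

entryAt-last : ∀ (xs : List ℕ) e → entryAt (xs ∷ʳ e) (suc (length xs)) ≡ e
entryAt-last []       e = refl
entryAt-last (x ∷ xs) e = entryAt-last xs e

∈-∷ʳ : ∀ xs {e : ℕ} → e ∈ xs ∷ʳ e
∈-∷ʳ []       = here refl
∈-∷ʳ (_ ∷ xs) = there (∈-∷ʳ xs)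

last-below : ∀ xs {e} → Linked _>_ (xs ∷ʳ e) → ∀ {z} → z ∈ xs → e < z
last-below (x ∷ xs) l (here refl) = below-head l (∈-∷ʳ xs)
last-below (x ∷ xs) l (there z∈) = last-below xs (Linked.tail l) z∈

indexOf-last : ∀ xs {e} → e ∉ xs → indexOf e (xs ∷ʳ e) ≡ suc (length xs)
indexOf-last []       {e} _ rewrite true-reflects (≡ᵇ-reflects-≡ e e) refl = refl
indexOf-last (x ∷ xs) {e} e∉ rewrite false-reflects (≡ᵇ-reflects-≡ x e) (λ x≡e → e∉ (here (sym x≡e))) =
  cong suc (indexOf-last xs (λ e∈ → e∉ (there e∈)))

rightOf-last : ∀ xs {e} → e ∉ xs → rightOf e (xs ∷ʳ e) ≡ 0
rightOf-last []       {e} _ rewrite true-reflects (≡ᵇ-reflects-≡ e e) refl = refl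
rightOf-last (x ∷ xs) {e} e∉ rewrite false-reflects (≡ᵇ-reflects-≡ x e) (λ x≡e → e∉ (here (sym x≡e))) =
  rightOf-last xs (λ e∈ → e∉ (there e∈))

module _ {R : List ℕ} {m : ℕ} where

  private module MinG = Min (<ᵇ-reflects-< m)

  smallestGreater-least : ∀ {y} → Least (m <_) R y → smallestGreater R m ≡ y
  smallestGreater-least least rewrite MinG.Extremal⇒best-filter R least = refl

  smallestGreater-spec : ∀ {y} → y ∈ R → m < y → Least (m <_) R (smallestGreater R m)
  smallestGreater-spec y∈ m<y with minM (filter (m <ᵇ_) R) in e
  ... | just s  = MinG.best-filter-just R e
  ... | nothing = contradiction m<y (MinG.best-filter-nothing R e y∈)

∸1< : ∀ {n} → 0 < n → n ∸ 1 < n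
∸1< {suc n} _ = n<1+n n

<∧∸1≤⇒≡ : ∀ {m n} → m < n → n ∸ 1 ≤ m → m ≡ n ∸ 1
<∧∸1≤⇒≡ {n = suc n} (s≤s m≤n) n≤m = ≤-antisym m≤n n≤m

ColDec-above : ∀ {A B} → ColDec A B → ∀ {z} → z ∈ B → Σ ℕ λ y → y ∈ A × z < y
ColDec-above {a ∷ _} {_ ∷ _} (b<a , _) (here refl) = a , here refl , b<a
ColDec-above {_ ∷ _} {_ ∷ _} (_ , cd) (there z∈) with ColDec-above cd z∈
... | y , y∈ , z<y = y , there y∈ , z<y

module _ {R : List ℕ} {rest : Tableau} {N : ℕ} where

  private module MaxLE = Max (λ z → ≤ᵇ-reflects-≤ z N)

  phiGo-T1 : (∀ {z} → z ∈ R → N < z) → phiGo (R ∷ rest) N ≡ ((R ∷ʳ N) ∷ rest , 1 , suc (length R) , true)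
  phiGo-T1 above rewrite MaxLE.none⇒best-filter R (λ z∈ → <⇒≱ (above z∈)) = refl

  module _ {n1 : ℕ} (n1-max : Greatest (_≤ N) R n1) where

    private
      D? = ≡ᵇ-reflects-≡ n1 N ×-reflects ∈ᵇ-reflects-∈ (N ∸ 1) R
      DR? = <ᵇ-reflects-< n1 N ×-reflects ¬-reflects (T-reflects (ejectable rest n1))

    phiGo-D : n1 ≡ N → N ∸ 1 ∈ R → phiGo (R ∷ rest) N ≡ shift (replace n1 N R) (phiGo rest (N ∸ 1))
    phiGo-D refl N-1∈ rewrite MaxLE.Extremal⇒best-filter R n1-max | true-reflects D? (refl , N-1∈) = refl

    phiGo-DR : n1 < N → ¬ Ejectable rest n1 → phiGo (R ∷ rest) N ≡ shift (replace n1 N R) (phiGo rest n1)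
    phiGo-DR n1<N ¬ej rewrite MaxLE.Extremal⇒best-filter R n1-max
      | false-reflects D? (λ (n1≡N , _) → <⇒≢ n1<N n1≡N) | true-reflects DR? (n1<N , ¬ej) = refl

    module _ (¬D : ¬ (n1 ≡ N × N ∸ 1 ∈ R)) (¬DR : ¬ (n1 < N × ¬ Ejectable rest n1)) where

      phiGo-IR1 : ∀ {y} → GreatestEjectable rest (rightOf n1 R) n1 y →
        phiGo (R ∷ rest) N ≡ shift (replace n1 N R) (phiGo rest y)
      phiGo-IR1 y-max rewrite MaxLE.Extremal⇒best-filter R n1-max | false-reflects D? ¬D | false-reflects DR? ¬DR
        | GreatestEjectable⇒maxM rest _ _ y-max = refl

      phiGo-IR2 : NoEjectable rest (rightOf n1 R) n1 → 0 < rightOf n1 R →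
        phiGo (R ∷ rest) N ≡ shift (replace n1 N R) (phiGo rest (rightOf n1 R))
      phiGo-IR2 none n2>0 rewrite MaxLE.Extremal⇒best-filter R n1-max | false-reflects D? ¬D | false-reflects DR? ¬DR
        | NoEjectable⇒maxM rest _ _ none | true-reflects (<ᵇ-reflects-< 0 _) n2>0 = refl

      phiGo-T2 : NoEjectable rest (rightOf n1 R) n1 → rightOf n1 R ≡ 0 →
        phiGo (R ∷ rest) N ≡ (replace n1 N R ∷ rest , 1 , indexOf n1 R , false)
      phiGo-T2 none n2≡0 rewrite MaxLE.Extremal⇒best-filter R n1-max | false-reflects D? ¬D | false-reflects DR? ¬DR
        | NoEjectable⇒maxM rest _ _ none | n2≡0 = refl

module _ {R : List ℕ} {rest : Tableau} {mi m : ℕ} {a : Bool} where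

  private DR? = T-reflects a ×-reflects ¬-reflects (∈ᵇ-reflects-∈ m R)

  processRow-D : mi ∸ 1 ∈ R → processRow R rest mi m a ≡ (R ∷ rest , mi , a)
  processRow-D mi-1∈ rewrite true-reflects (∈ᵇ-reflects-∈ _ R) mi-1∈ = refl

  module _ (mi-1∉ : mi ∸ 1 ∉ R) where

    processRow-DR : T a → m ∉ R → processRow R rest mi m a ≡ (replace mi m R ∷ rest , mi , true)
    processRow-DR a-true m∉ rewrite false-reflects (∈ᵇ-reflects-∈ _ R) mi-1∉ | true-reflects DR? (a-true , m∉) = refl

    module _ (¬DR : ¬ (T a × m ∉ R)) where

      processRow-IR : ∀ {x} → LeastEjectable rest m mi x → processRow R rest mi m a ≡ (replace mi x R ∷ rest , mi , true)
      processRow-IR x-min rewrite false-reflects (∈ᵇ-reflects-∈ _ R) mi-1∉ | false-reflects DR? ¬DR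
        | LeastEjectable⇒minM rest _ _ x-min = refl

      processRow-NR : NoEjectable rest m mi → processRow R rest mi m a ≡ (R ∷ rest , mi , false)
      processRow-NR none rewrite false-reflects (∈ᵇ-reflects-∈ _ R) mi-1∉ | false-reflects DR? ¬DR
        | NoEjectable⇒minM rest _ _ none = refl

RowRestored : List ℕ → Tableau → ℕ → ℕ → ℕ → Set
RowRestored R rest n1 N N′ =
  let R′ = replace n1 N R in
  processRow R′ rest (smallestGreater R′ N′) N′ (not (ejectable rest N′)) ≡ (R ∷ rest , N , not (ejectable (R ∷ rest) N))

module _ {R : List ℕ} {rest : Tableau} {n1 k : ℕ} (n1-max : Greatest (_≤ suc k) R n1) where

  private
    N = suc k
    R′ = replace n1 N R

  N∉ : n1 < N → N ∉ R
  N∉ n1<N N∈ = <-irrefl refl (≤-<-trans (proj₂ (proj₂ n1-max) N∈ ≤-refl) n1<N)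

  pred∉-replace : ¬ (n1 ≡ N × k ∈ R) → k ∉ R′
  pred∉-replace ¬D k∈ with ∈-replace⁻ n1 N R k∈
  ... | inj₁ (k≡N , _) = <-irrefl k≡N ≤-refl
  ... | inj₂ (k∈R , k≢n1) with proj₂ (proj₂ n1-max) k∈R (n≤1+n k)
  ... | k≤n1 = ¬D (≤-antisym (proj₁ (proj₂ n1-max)) (≤∧≢⇒< k≤n1 k≢n1) , k∈R)

  smallestGreater-replace : ∀ {lo} → lo < N → (∀ {z} → z ∈ R → z < n1 → z ≤ lo) → smallestGreater R′ lo ≡ N
  smallestGreater-replace {lo} lo<N below = smallestGreater-least (∈-replace-new n1 N R (proj₁ n1-max) , lo<N , least)
    where
    least : ∀ {z} → z ∈ R′ → lo < z → N ≤ z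
    least {z} z∈ lo<z with ∈-replace⁻ n1 N R z∈
    ... | inj₁ (refl , _) = ≤-refl
    ... | inj₂ (z∈R , z≢n1) with ≤-total N z
    ...   | inj₁ N≤z = N≤z
    ...   | inj₂ z≤N = contradiction (below z∈R (≤∧≢⇒< (proj₂ (proj₂ n1-max) z∈R z≤N) z≢n1)) (<⇒≱ lo<z)

  replaced-back : n1 < N →
    _≡_ {A = Tableau × ℕ × Bool} (replace N n1 R′ ∷ rest , N , true) (R ∷ rest , N , not (ejectable (R ∷ rest) N))
  replaced-back n1<N =
    cong₂ (λ X b → (X ∷ rest , N , b)) (replace-inverse n1 N R (N∉ n1<N)) (cong not (sym (ejectable-∉ rest (N∉ n1<N))))

  restored-DR : n1 < N → ¬ Ejectable rest n1 → RowRestored R rest n1 N n1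
  restored-DR n1<N ¬ej rewrite smallestGreater-replace n1<N (λ _ → <⇒≤) =
    begin
      processRow R′ rest N n1 (not (ejectable rest n1))
    ≡⟨ processRow-DR (pred∉-replace λ (n1≡N , _) → <⇒≢ n1<N n1≡N) (¬T⇒T-not ¬ej)
                     (replaced∉ n1 N R (<⇒≢ n1<N)) ⟩
      (replace N n1 R′ ∷ rest , N , true)
    ≡⟨ replaced-back n1<N ⟩
      (R ∷ rest , N , not (ejectable (R ∷ rest) N))
    ∎
    where open ≡-Reasoning

  processRow-restores : ¬ (n1 ≡ N × k ∈ R) → ¬ (n1 < N × ¬ Ejectable rest n1) →
    ∀ {lo β} → lo < n1 → NoEjectable rest lo n1 → ¬ (T β × lo ∉ R′) →
    processRow R′ rest N lo β ≡ (R ∷ rest , N , not (ejectable (R ∷ rest) N))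
  processRow-restores ¬D ¬DR {lo} lo<n1 none ¬DRΨ with m≤n⇒m<n∨m≡n (proj₁ (proj₂ n1-max))
  ... | inj₁ n1<N =
    trans (processRow-IR (pred∉-replace ¬D) ¬DRΨ n1-least) (replaced-back n1<N)
    where
    n1-least : LeastEjectable rest lo N n1
    n1-least = (¬¬T⇒T (λ ¬ej → ¬DR (n1<N , ¬ej)) , lo<n1 , n1<N) , least
      where
      least : ∀ {z} → EjectableBetween rest lo N z → n1 ≤ z
      least {z} (ej , lo<z , z<N) with <-cmp z n1
      ... | tri< z<n1 _ _ = contradiction (ej , lo<z , z<n1) none
      ... | tri≈ _ refl _ = ≤-refl
      ... | tri> _ _ n1<z = <⇒≤ n1<z
  ... | inj₂ refl rewrite replace-id n1 R =
    trans (processRow-NR k∉ ¬DRΨ none) (cong (λ b → (R ∷ rest , N , not b)) (sym (ejectable-pred∉ rest (proj₁ n1-max) k∉)))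
    where
    k∉ : k ∉ R
    k∉ = subst (k ∉_) (replace-id n1 R) (pred∉-replace ¬D)

  restored-IR : ¬ (n1 ≡ N × k ∈ R) → ¬ (n1 < N × ¬ Ejectable rest n1) →
    ∀ {lo} → lo < n1 → NoEjectable rest lo n1 → (∀ {z} → z ∈ R → z < n1 → z ≤ lo) →
    Ejectable rest lo ⊎ lo ∈ R → RowRestored R rest n1 N lo
  restored-IR ¬D ¬DR {lo} lo<n1 none below ej⊎∈
    rewrite smallestGreater-replace (<-≤-trans lo<n1 (proj₁ (proj₂ n1-max))) below =
    processRow-restores ¬D ¬DR lo<n1 none ¬DRΨ
    where
    ¬DRΨ : ¬ (T (not (ejectable rest lo)) × lo ∉ R′)
    ¬DRΨ (¬ej , lo∉) = [ T-not⇒¬T ¬ej , (λ lo∈R → lo∉ (∈-replace-old n1 N R lo∈R (<⇒≢ lo<n1))) ] ej⊎∈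

restored-D : ∀ {R rest k} → suc k ∈ R → k ∈ R → RowRestored R rest (suc k) (suc k) k
restored-D {R} {rest} {k} N∈ k∈
  rewrite replace-id (suc k) R | smallestGreater-least {R} {k} (N∈ , ≤-refl , λ _ k<z → k<z) =
  trans (processRow-D k∈) (cong (λ b → (R ∷ rest , suc k , not b)) (sym (ejectable-pred∈ rest N∈ k∈)))

InvertsAt : Tableau → ℕ → Set
InvertsAt P N = ∀ {P′ r c α} → phiGo P N ≡ (P′ , r , c , α) → psiGo P′ r c α ≡ (P , N , not (ejectable P N))

psiGo-row0 : ∀ P c α → proj₁ (proj₂ (psiGo P 0 c α)) ≡ 0
psiGo-row0 []      c α = refl
psiGo-row0 (_ ∷ _) c α = refl

psiGo-shift : ∀ {R′ rest N′} → InvertsAt rest N′ → 0 < N′ → ∀ {P′ r c α} →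
  shift R′ (phiGo rest N′) ≡ (P′ , r , c , α) →
  psiGo P′ r c α ≡ processRow R′ rest (smallestGreater R′ N′) N′ (not (ejectable rest N′))
psiGo-shift {R′} {rest} {N′} ih N′>0 = go refl
  where
  go : ∀ {o P′ r c α} → phiGo rest N′ ≡ o → shift R′ o ≡ (P′ , r , c , α) →
    psiGo P′ r c α ≡ processRow R′ rest (smallestGreater R′ N′) N′ (not (ejectable rest N′))
  go {P″ , zero , c″ , α″} e refl =
    contradiction (trans (sym (cong (proj₁ ∘ proj₂) (ih e))) (psiGo-row0 P″ c″ α″)) (>⇒≢ N′>0)
  go {P″ , suc r″ , c″ , α″} e refl rewrite ih e = refl

data InsertionStep (R : List ℕ) (rest : Tableau) (N : ℕ) : Set where
  final : InvertsAt (R ∷ rest) N → InsertionStep R rest N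
  bumps : ∀ {n1 N′} → 0 < N′ → phiGo (R ∷ rest) N ≡ shift (replace n1 N R) (phiGo rest N′) →
          RowRestored R rest n1 N N′ → InsertionStep R rest N

invertsAt-T1 : ∀ {R rest N} → NonEmpty R → (∀ {z} → z ∈ R → N < z) → InvertsAt (R ∷ rest) N
invertsAt-T1 {x ∷ xs} {rest} {N} _ above eq with trans (sym (phiGo-T1 above)) eq
... | refl rewrite take-length-∷ʳ (x ∷ xs) N | entryAt-last (x ∷ xs) N
  | ejectable-∉ rest (λ N∈ → <-irrefl refl (above N∈)) = refl

module _ {R : List ℕ} {rest : Tableau} {n1 k : ℕ}
         (pos : All (0 <_) R) (dec : Linked _>_ R) (n1-max : Greatest (_≤ suc k) R n1)
         (¬D : ¬ (n1 ≡ suc k × k ∈ R)) (¬DR : ¬ (n1 < suc k × ¬ Ejectable rest n1)) where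

  private n1>0 = All.lookup pos (proj₁ n1-max)

  invertsAt-T2 : NoEjectable rest (rightOf n1 R) n1 → rightOf n1 R ≡ 0 → InvertsAt (R ∷ rest) (suc k)
  invertsAt-T2 none n2≡0 eq with trans (sym (phiGo-T2 n1-max ¬D ¬DR none n2≡0)) eq
  ... | refl rewrite entryAt-replace-indexOf n1 (suc k) R (proj₁ n1-max) =
    processRow-restores n1-max ¬D ¬DR n1>0 (subst (λ lo → NoEjectable rest lo n1) n2≡0 none) λ ()

  insertionStep-IR : InsertionStep R rest (suc k)
  insertionStep-IR with maxM (ejectablesBetween rest (rightOf n1 R) n1) in e
  ... | just y = bumps (≤-<-trans z≤n n2<y) (phiGo-IR1 n1-max ¬D ¬DR y-max)
                       (restored-IR n1-max ¬D ¬DR y<n1 none-above below (inj₁ y-ej))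
    where
    y-max = maxEjectable-just rest _ _ e
    y-ej = proj₁ (proj₁ y-max)
    n2<y = proj₁ (proj₂ (proj₁ y-max))
    y<n1 = proj₂ (proj₂ (proj₁ y-max))
    none-above : NoEjectable rest y n1
    none-above (ej , y<z , z<n1) = <⇒≱ y<z (proj₂ y-max (ej , <-trans n2<y y<z , z<n1))
    below : ∀ {z} → z ∈ R → z < n1 → z ≤ y
    below z∈ z<n1 with rightOf-spec dec (proj₁ n1-max)
    ... | inj₁ (_ , nothing-below) = contradiction z<n1 (nothing-below z∈)
    ... | inj₂ (_ , _ , n2-max) = ≤-trans (n2-max z∈ z<n1) (<⇒≤ n2<y)
  ... | nothing with rightOf-spec dec (proj₁ n1-max)
  ...   | inj₁ (n2≡0 , _) = final (invertsAt-T2 (maxEjectable-nothing rest _ _ e) n2≡0)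
  ...   | inj₂ (n2∈ , n2<n1 , n2-max) =
    bumps (All.lookup pos n2∈)
          (phiGo-IR2 n1-max ¬D ¬DR none (All.lookup pos n2∈))
          (restored-IR n1-max ¬D ¬DR n2<n1 none n2-max (inj₂ n2∈))
    where none = maxEjectable-nothing rest _ _ e

insertionStep : ∀ {R rest k} → WellFormedRow R → InsertionStep R rest (suc k)
insertionStep {R} {rest} {k} (ne , pos , dec) with maxM (filter (_≤ᵇ suc k) R) in e
... | nothing = final (invertsAt-T1 ne λ z∈ → ≰⇒> (Max.best-filter-nothing (λ z → ≤ᵇ-reflects-≤ z (suc k)) R e z∈))
... | just n1 with Max.best-filter-just (λ z → ≤ᵇ-reflects-≤ z (suc k)) R e
...   | n1-max with (n1 ≟ suc k) ×-dec (k ∈? R)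
...     | yes (refl , k∈) = bumps (All.lookup pos k∈) (phiGo-D n1-max refl k∈) (restored-D (proj₁ n1-max) k∈)
...     | no ¬D with (n1 <? suc k) ×-dec ¬? (T? (ejectable rest n1))
...       | yes (n1<N , ¬ej) = bumps (All.lookup pos (proj₁ n1-max))
                                     (phiGo-DR n1-max n1<N ¬ej) (restored-DR n1-max n1<N ¬ej)
...       | no ¬DR = insertionStep-IR pos dec n1-max ¬D ¬DR

psiGo-phiGo : ∀ {P N} → All WellFormedRow P → 0 < N → InvertsAt P N
psiGo-phiGo [] _ refl = refl
psiGo-phiGo {R ∷ rest} {suc k} (R-ok ∷ rest-ok) _ eq with insertionStep {rest = rest} {k} R-ok
... | final inverts = inverts eq
... | bumps N′>0 φ≡ restored = trans (psiGo-shift (psiGo-phiGo rest-ok N′>0) N′>0 (trans (sym φ≡) eq)) restored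

module _ {R : List ℕ} {m′ mi : ℕ} (dec : Linked _>_ R) (mi-min : Least (m′ <_) R mi) where

  private
    mi∈ = proj₁ mi-min
    m′<mi = proj₁ (proj₂ mi-min)

  below-least : ∀ {z} → z ∈ R → z < mi → z ≤ m′
  below-least z∈ z<mi = ≮⇒≥ λ m′<z → <⇒≱ z<mi (proj₂ (proj₂ mi-min) z∈ m′<z)

  rightOf-least-≡ : m′ ∈ R → rightOf mi R ≡ m′
  rightOf-least-≡ m′∈ with rightOf-spec dec mi∈
  ... | inj₁ (_ , nothing-below) = contradiction m′<mi (nothing-below m′∈)
  ... | inj₂ (n2∈ , n2<mi , n2-max) = ≤-antisym (below-least n2∈ n2<mi) (n2-max m′∈ m′<mi)

  rightOf-least-< : 0 < m′ → m′ ∉ R → rightOf mi R < m′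
  rightOf-least-< m′>0 m′∉ with rightOf-spec dec mi∈
  ... | inj₁ (n2≡0 , _) rewrite n2≡0 = m′>0
  ... | inj₂ (n2∈ , n2<mi , _) = ≤∧≢⇒< (below-least n2∈ n2<mi) (λ n2≡m′ → m′∉ (subst (_∈ R) n2≡m′ n2∈))

  replace-greatest : ∀ {x} → m′ ≤ x → x ≤ mi → Greatest (_≤ mi) (replace mi x R) x
  replace-greatest {x} m′≤x x≤mi = ∈-replace-new mi x R mi∈ , x≤mi , greatest
    where
    greatest : ∀ {z} → z ∈ replace mi x R → z ≤ mi → z ≤ x
    greatest z∈ z≤mi with ∈-replace⁻ mi x R z∈
    ... | inj₁ (refl , _) = ≤-refl
    ... | inj₂ (z∈R , z≢mi) = ≤-trans (below-least z∈R (≤∧≢⇒< z≤mi z≢mi)) m′≤x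

  phiGo-resumes : ∀ {X rest′ w} → Greatest (_≤ mi) X w →
    ¬ (w ≡ mi × mi ∸ 1 ∈ X) → ¬ (w < mi × ¬ Ejectable rest′ w) → rightOf w X ≡ rightOf mi R →
    0 < m′ → m′ < w → NoEjectable rest′ m′ w → (m′ ∉ R → Ejectable rest′ m′) →
    phiGo (X ∷ rest′) mi ≡ shift (replace w mi X) (phiGo rest′ m′)
  -- If m′ ∈ R it is the entry right of w (case IR2); otherwise it is the largest ejectable value below w (IR1).
  phiGo-resumes {X} {rest′} {w} w-max ¬D ¬DR n2≡ m′>0 m′<w none m′-ej with m′ ∈? R
  ... | yes m′∈ = trans (phiGo-IR2 w-max ¬D ¬DR (subst (λ lo → NoEjectable rest′ lo w) (sym n2≡m′) none)
                                   (subst (0 <_) (sym n2≡m′) m′>0))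
                        (cong (λ N′ → shift (replace w mi X) (phiGo rest′ N′)) n2≡m′)
    where n2≡m′ = trans n2≡ (rightOf-least-≡ m′∈)
  ... | no m′∉ = phiGo-IR1 w-max ¬D ¬DR ((m′-ej m′∉ , n2<m′ , m′<w) , greatest)
    where
    n2<m′ = subst (_< m′) (sym n2≡) (rightOf-least-< m′>0 m′∉)
    greatest : ∀ {z} → EjectableBetween rest′ (rightOf w X) w z → z ≤ m′
    greatest (ej , _ , z<w) = ≮⇒≥ λ m′<z → none (ej , m′<z , z<w)

UndoesRow : List ℕ → Tableau → ℕ → Tableau → ℕ → Bool → Set
UndoesRow R rest′ m′ Q mi a = (phiGo Q mi ≡ shift R (phiGo rest′ m′)) × (a ≡ not (ejectable Q mi))

module _ {R : List ℕ} {rest′ : Tableau} {m′ mi : ℕ} {a′ : Bool}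
         (dec : Linked _>_ R) (mi-min : Least (m′ <_) R mi) (m′>0 : 0 < m′)
         (a′≡ : a′ ≡ not (ejectable rest′ m′)) where

  private
    mi∈ = proj₁ mi-min
    m′<mi = proj₁ (proj₂ mi-min)

    self-greatest : Greatest (_≤ mi) R mi
    self-greatest = mi∈ , ≤-refl , λ _ z≤mi → z≤mi

    ¬DR-of-ejectable : ∀ {x} → Ejectable rest′ x → ¬ (x < mi × ¬ Ejectable rest′ x)
    ¬DR-of-ejectable ej (_ , ¬ej) = ¬ej ej

    ejectable-of-¬DRΨ : ¬ (T a′ × m′ ∉ R) → m′ ∉ R → Ejectable rest′ m′
    ejectable-of-¬DRΨ ¬DRΨ m′∉ = ¬¬T⇒T λ ¬ej → ¬DRΨ (subst T (sym a′≡) (¬T⇒T-not ¬ej) , m′∉)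

  undoes-D : mi ∸ 1 ∈ R → UndoesRow R rest′ m′ (R ∷ rest′) mi a′
  undoes-D mi-1∈ =
    (begin
      phiGo (R ∷ rest′) mi                              ≡⟨ phiGo-D self-greatest refl mi-1∈ ⟩
      shift (replace mi mi R) (phiGo rest′ (mi ∸ 1))
        ≡⟨ cong₂ (λ X n → shift X (phiGo rest′ n)) (replace-id mi R) (sym m′≡mi-1) ⟩
      shift R (phiGo rest′ m′)                          ∎) ,
    (begin
      a′                                  ≡⟨ a′≡ ⟩
      not (ejectable rest′ m′)            ≡⟨ cong (not ∘ ejectable rest′) m′≡mi-1 ⟩
      not (ejectable rest′ (mi ∸ 1))      ≡⟨ cong not (sym (ejectable-pred∈ rest′ mi∈ mi-1∈)) ⟩
      not (ejectable (R ∷ rest′) mi)      ∎)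
    where
    open ≡-Reasoning
    m′≡mi-1 : m′ ≡ mi ∸ 1
    m′≡mi-1 = <∧∸1≤⇒≡ m′<mi (below-least dec mi-min mi-1∈ (∸1< (≤-<-trans z≤n m′<mi)))

  undoes-DR : T a′ → m′ ∉ R → UndoesRow R rest′ m′ (replace mi m′ R ∷ rest′) mi true
  undoes-DR a′-true m′∉ =
    trans (phiGo-DR (replace-greatest dec mi-min ≤-refl (<⇒≤ m′<mi)) m′<mi (T-not⇒¬T (subst T a′≡ a′-true)))
          (cong (λ X → shift X (phiGo rest′ m′)) (replace-inverse mi m′ R m′∉)) ,
    cong not (sym (ejectable-∉ rest′ (replaced∉ mi m′ R (>⇒≢ m′<mi))))

  undoes-IR : ¬ (T a′ × m′ ∉ R) → ∀ {x} → LeastEjectable rest′ m′ mi x →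
    UndoesRow R rest′ m′ (replace mi x R ∷ rest′) mi true
  undoes-IR ¬DRΨ {x} ((x-ej , m′<x , x<mi) , least) =
    trans (phiGo-resumes dec mi-min (replace-greatest dec mi-min (<⇒≤ m′<x) (<⇒≤ x<mi))
             (λ (x≡mi , _) → <⇒≢ x<mi x≡mi) (¬DR-of-ejectable x-ej) (rightOf-replace mi x R dec x∉ mi∈)
             m′>0 m′<x none (ejectable-of-¬DRΨ ¬DRΨ))
          (cong (λ X → shift X (phiGo rest′ m′)) (replace-inverse mi x R x∉)) ,
    cong not (sym (ejectable-∉ rest′ (replaced∉ mi x R (>⇒≢ x<mi))))
    where
    x∉ : x ∉ R
    x∉ x∈ = <⇒≱ x<mi (proj₂ (proj₂ mi-min) x∈ m′<x)
    none : NoEjectable rest′ m′ x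
    none (ej , m′<z , z<x) = <⇒≱ z<x (least (ej , m′<z , <-trans z<x x<mi))

  undoes-NR : mi ∸ 1 ∉ R → ¬ (T a′ × m′ ∉ R) → NoEjectable rest′ m′ mi →
    UndoesRow R rest′ m′ (R ∷ rest′) mi false
  undoes-NR mi-1∉ ¬DRΨ none =
    trans (phiGo-resumes dec mi-min self-greatest (λ (_ , mi-1∈) → mi-1∉ mi-1∈) (λ (mi<mi , _) → <-irrefl refl mi<mi)
             refl m′>0 m′<mi none (ejectable-of-¬DRΨ ¬DRΨ))
          (cong (λ X → shift X (phiGo rest′ m′)) (replace-id mi R)) ,
    cong not (sym (ejectable-pred∉ rest′ mi∈ mi-1∉))

  private
    undone : ∀ {Q a Q′ m a″} → UndoesRow R rest′ m′ Q mi a → (Q , mi , a) ≡ (Q′ , m , a″) →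
      UndoesRow R rest′ m′ Q′ m a″ × m ≡ mi
    undone u refl = u , refl

    undone-IR-NR : mi ∸ 1 ∉ R → ¬ (T a′ × m′ ∉ R) → ∀ {o} → minM (ejectablesBetween rest′ m′ mi) ≡ o →
      ∀ {Q m a} → processRow R rest′ mi m′ a′ ≡ (Q , m , a) → UndoesRow R rest′ m′ Q m a × m ≡ mi
    undone-IR-NR mi-1∉ ¬DRΨ {just x} e eq =
      undone (undoes-IR ¬DRΨ x-min) (trans (sym (processRow-IR mi-1∉ ¬DRΨ x-min)) eq)
      where x-min = minEjectable-just rest′ m′ mi e
    undone-IR-NR mi-1∉ ¬DRΨ {nothing} e eq =
      undone (undoes-NR mi-1∉ ¬DRΨ none) (trans (sym (processRow-NR mi-1∉ ¬DRΨ none)) eq)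
      where none = minEjectable-nothing rest′ m′ mi e

  processRow-undone : ∀ {Q m a} → processRow R rest′ mi m′ a′ ≡ (Q , m , a) → UndoesRow R rest′ m′ Q m a × m ≡ mi
  processRow-undone eq with mi ∸ 1 ∈? R
  ... | yes mi-1∈ = undone (undoes-D mi-1∈) (trans (sym (processRow-D mi-1∈)) eq)
  ... | no mi-1∉ with T? a′ ×-dec ¬? (m′ ∈? R)
  ...   | yes (a′-true , m′∉) = undone (undoes-DR a′-true m′∉) (trans (sym (processRow-DR mi-1∉ a′-true m′∉)) eq)
  ...   | no ¬DRΨ = undone-IR-NR mi-1∉ ¬DRΨ refl eq

-- m ∈ firstRow P is what lets the row above find an entry larger than m, by column strictness.
Undoes : Tableau → ℕ → ℕ → Bool → Tableau → ℕ → Bool → Set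
Undoes P r c α P′ m a = (phiGo P′ m ≡ (P , r , c , α)) × (a ≡ not (ejectable P′ m)) × (m ∈ firstRow P)

Undoes-result : ∀ {P r c α Q e a Q′ m a′} → Undoes P r c α Q e a → (Q , e , a) ≡ (Q′ , m , a′) →
  Undoes P r c α Q′ m a′
Undoes-result u refl = u

last-least : ∀ xs {e} → WellFormedRow (xs ∷ʳ e) → Least (0 <_) (xs ∷ʳ e) e
last-least xs (_ , pos , dec) = ∈-∷ʳ xs , All.lookup pos (∈-∷ʳ xs) , least
  where
  least : ∀ {z} → z ∈ xs ∷ʳ _ → 0 < z → _ ≤ z
  least z∈ _ with ∈-++⁻ xs z∈
  ... | inj₁ z∈xs = <⇒≤ (last-below xs dec z∈xs)
  ... | inj₂ (here refl) = ≤-refl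

undoes-removal : ∀ xs {e rest} → WellFormedRow (xs ∷ʳ e) → All WellFormedRow rest →
  length (rowAt rest 1) < suc (length xs) →
  Undoes ((xs ∷ʳ e) ∷ rest) 1 (suc (length xs)) true (if null xs then rest else xs ∷ rest) e true
undoes-removal [] {rest = []}          _ _                 _        = refl , refl , here refl
undoes-removal [] {rest = [] ∷ _}      _ ((() , _) ∷ _)    _
undoes-removal [] {rest = (_ ∷ _) ∷ _} _ _                 (s≤s ())
undoes-removal (x ∷ xs) {e} {rest} (_ , _ , dec) _ _ =
  phiGo-T1 (last-below (x ∷ xs) dec) , cong not (sym (ejectable-∉ rest e∉)) , ∈-∷ʳ (x ∷ xs)
  where
  e∉ : e ∉ x ∷ xs
  e∉ e∈ = <-irrefl refl (last-below (x ∷ xs) dec e∈)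

module _ (xs : List ℕ) {e : ℕ} {rest : Tableau} (R-ok : WellFormedRow (xs ∷ʳ e)) where

  private
    R = xs ∷ʳ e
    dec = proj₂ (proj₂ R-ok)
    e-least = last-least xs R-ok
    e∈ = proj₁ e-least
    e∉xs : e ∉ xs
    e∉xs e∈xs = <-irrefl refl (last-below xs dec e∈xs)
    rightOf-e≡0 : rightOf e R ≡ 0
    rightOf-e≡0 = rightOf-last xs e∉xs

  undoes-IR-bottom : ∀ {x} → LeastEjectable rest 0 e x →
    Undoes (R ∷ rest) 1 (suc (length xs)) false (replace e x R ∷ rest) e true
  undoes-IR-bottom {x} ((x-ej , x>0 , x<e) , least) =
    trans (phiGo-T2 (replace-greatest dec e-least z≤n (<⇒≤ x<e)) (λ (x≡e , _) → <⇒≢ x<e x≡e) (λ (_ , ¬ej) → ¬ej x-ej)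
                    none n2≡0)
          (cong₂ (λ X c → (X ∷ rest , 1 , c , false)) (replace-inverse e x R x∉)
                 (trans (indexOf-replace e x R x∉) (indexOf-last xs e∉xs))) ,
    cong not (sym (ejectable-∉ rest (replaced∉ e x R (>⇒≢ x<e)))) ,
    e∈
    where
    x∉ : x ∉ R
    x∉ x∈ = <⇒≱ x<e (proj₂ (proj₂ e-least) x∈ x>0)
    n2≡0 : rightOf x (replace e x R) ≡ 0
    n2≡0 = trans (rightOf-replace e x R dec x∉ e∈) rightOf-e≡0
    none : NoEjectable rest (rightOf x (replace e x R)) x
    none rewrite n2≡0 = λ (ej , z>0 , z<x) → <⇒≱ z<x (least (ej , z>0 , <-trans z<x x<e))

  undoes-NR-bottom : e ∸ 1 ∉ R → NoEjectable rest 0 e → Undoes (R ∷ rest) 1 (suc (length xs)) false (R ∷ rest) e false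
  undoes-NR-bottom e-1∉ none =
    trans (phiGo-T2 (e∈ , ≤-refl , λ _ z≤e → z≤e) (λ (_ , e-1∈) → e-1∉ e-1∈) (λ (e<e , _) → <-irrefl refl e<e)
                    (subst (λ lo → NoEjectable rest lo e) (sym rightOf-e≡0) none) rightOf-e≡0)
          (cong₂ (λ X c → (X ∷ rest , 1 , c , false)) (replace-id e R) (indexOf-last xs e∉xs)) ,
    cong not (sym (ejectable-pred∉ rest e∈ e-1∉)) ,
    e∈

  undoes-insertion-end : ∀ {Q m a} → processRow R rest e 0 false ≡ (Q , m , a) →
    Undoes (R ∷ rest) 1 (suc (length xs)) false Q m a
  undoes-insertion-end = case refl
    where
    e-1∉ : e ∸ 1 ∉ R
    e-1∉ e-1∈ =
      <⇒≱ (∸1< (proj₁ (proj₂ e-least))) (proj₂ (proj₂ e-least) e-1∈ (All.lookup (proj₁ (proj₂ R-ok)) e-1∈))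
    ¬DRΨ : ¬ (T false × 0 ∉ R)
    ¬DRΨ ()
    case : ∀ {o} → minM (ejectablesBetween rest 0 e) ≡ o → ∀ {Q m a} → processRow R rest e 0 false ≡ (Q , m , a) →
      Undoes (R ∷ rest) 1 (suc (length xs)) false Q m a
    case {just x} eo eq = Undoes-result (undoes-IR-bottom x-min) (trans (sym (processRow-IR e-1∉ ¬DRΨ x-min)) eq)
      where x-min = minEjectable-just rest 0 e eo
    case {nothing} eo eq = Undoes-result (undoes-NR-bottom e-1∉ none) (trans (sym (processRow-NR e-1∉ ¬DRΨ none)) eq)
      where none = minEjectable-nothing rest 0 e eo

bottom-undone : ∀ {R rest c α P′ m a} → WellFormedRow R → All WellFormedRow rest →
  1 ≤ c → length R ≡ c → length (rowAt rest 1) < c →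
  psiGo (R ∷ rest) 1 c α ≡ (P′ , m , a) → Undoes (R ∷ rest) 1 c α P′ m a
bottom-undone {R} {rest} {c} {α} {P′} {m} {a} R-ok rest-ok c≥1 len short eq with initLast R
... | [] = contradiction (subst (1 ≤_) (sym len) c≥1) λ ()
... | xs ∷ʳ′ e with trans (sym (length-∷ʳ xs e)) len
...   | refl with α
...     | true = Undoes-result (undoes-removal xs R-ok rest-ok short) (trans (sym removed) eq)
  where
  removed : psiGo ((xs ∷ʳ e) ∷ rest) 1 (suc (length xs)) true ≡ ((if null xs then rest else xs ∷ rest) , e , true)
  removed rewrite take-length-∷ʳ xs e | entryAt-last xs e = refl
...     | false =
  undoes-insertion-end xs R-ok (subst (λ e′ → processRow (xs ∷ʳ e) rest e′ 0 false ≡ (P′ , m , a)) (entryAt-last xs e) eq)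

row-above : ∀ {R rest m′} → Linked ColDec (R ∷ rest) → All WellFormedRow rest → m′ ∈ firstRow rest →
  0 < m′ × Σ ℕ λ y → y ∈ R × m′ < y
row-above {rest = _ ∷ _} (cd ∷ _) ((_ , pos , _) ∷ _) m′∈ = All.lookup pos m′∈ , ColDec-above cd m′∈

phiGo-psiGo : ∀ {P r c α P′ m a} → All WellFormedRow P → Linked ColDec P → Removable P r c →
  psiGo P r c α ≡ (P′ , m , a) → Undoes P r c α P′ m a
phiGo-psiGo {[]} _ _ (_ , c≥1 , refl , _) _ = contradiction c≥1 λ ()
phiGo-psiGo {R ∷ rest} {zero} _ _ (() , _) _
phiGo-psiGo {R ∷ rest} {suc zero} (R-ok ∷ rest-ok) _ (_ , c≥1 , len , short) eq = bottom-undone R-ok rest-ok c≥1 len short eq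
phiGo-psiGo {R ∷ rest} {suc (suc r)} {c} {α} (R-ok ∷ rest-ok) cd (_ , c≥1 , len , short) eq with psiGo rest (suc r) c α in e
... | rest′ , m′ , a′ with phiGo-psiGo rest-ok (Linked.tail cd) (s≤s z≤n , c≥1 , len , short) e
... | φ≡ , a′≡ , m′∈ with row-above cd rest-ok m′∈
... | m′>0 , y , y∈ , m′<y with smallestGreater-spec y∈ m′<y
... | mi-min with processRow-undone (proj₂ (proj₂ R-ok)) mi-min m′>0 a′≡ eq
... | (φ′≡ , a≡) , m≡mi = trans φ′≡ (cong (shift R) φ≡) , a≡ , subst (_∈ R) (sym m≡mi) (proj₁ mi-min)

IsDecreasingTableau⇒wellFormedRows : ∀ {P} → IsDecreasingTableau P → All WellFormedRow P
IsDecreasingTableau⇒wellFormedRows (nonEmpty , positive , decreasing , _) = zip (nonEmpty , zip (positive , decreasing))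

Φ-undoes-Ψ : (P : Tableau) (r c : ℕ) (α : Bool) → IsDecreasingTableau P → Removable P r c →
  (P′ : Tableau) (m : ℕ) → Ψ P r c α ≡ (P′ , m) → Φ P′ m ≡ (P , r , c , α)
Φ-undoes-Ψ P r c α P-dec removable P′ m eq with psiGo P r c α in e
... | _ , _ , _ with eq
...   | refl = proj₁ (phiGo-psiGo (IsDecreasingTableau⇒wellFormedRows P-dec) (proj₂ (proj₂ (proj₂ P-dec))) removable e)

Ψ-undoes-Φ : (P : Tableau) (m : ℕ) → IsDecreasingTableau P → 0 < m →
  (P′ : Tableau) (r c : ℕ) (α : Bool) → Φ P m ≡ (P′ , r , c , α) → Ψ P′ r c α ≡ (P , m)
Ψ-undoes-Φ P m P-dec m>0 P′ r c α eq
  rewrite psiGo-phiGo (IsDecreasingTableau⇒wellFormedRows P-dec) m>0 eq = refl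

theorem5p3 :
    ((P : Tableau) (r c : ℕ) (α : Bool) → IsDecreasingTableau P → Removable P r c →
      (P' : Tableau) (m : ℕ) → Ψ P r c α ≡ (P' , m) → Φ P' m ≡ (P , r , c , α))
    × ((P : Tableau) (m : ℕ) → IsDecreasingTableau P → 0 < m →
      (P' : Tableau) (r c : ℕ) (α : Bool) → Φ P m ≡ (P' , r , c , α) → Ψ P' r c α ≡ (P , m))
theorem5p3 = Φ-undoes-Ψ , Ψ-undoes-Φ
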